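{- Let $n=n_1n_2$ with $n_1,n_2$ positive integers, and let $A\subseteq\mathbb{Z}_n$, $A_1\subseteq\mathbb{Z}_{n_1}$, $A_2\subseteq\mathbb{Z}_{n_2}$ be non-empty subsets such that, for $i=1,2$, the image of $A$ under the natural map $\mathbb{Z}_n\to\mathbb{Z}_{n_i}$ is contained in $A_i$. Then $D_A(\mathbb{Z}_n)\ge D_{A_1}(\mathbb{Z}_{n_1})+D_{A_2}(\mathbb{Z}_{n_2})-1$.
   Context: $\mathbb{Z}_m=\mathbb{Z}/m\mathbb{Z}$. A sequence over $\mathbb{Z}_m$ is a finite unordered list (multiset) of elements of $\mathbb{Z}_m$; subsequences are sub-multisets. For a non-empty weight set $B\subseteq\mathbb{Z}_m$, a sequence $x_1\cdots x_k$ is a $B$-weighted zero-sum sequence if there exist $b_1,\dots,b_k\in B$ with $\sum_{i=1}^k b_ix_i=0$ in $\mathbb{Z}_m$. $D_B(\mathbb{Z}_m)$ is the least positive integer $\ell$ such that every sequence over $\mathbb{Z}_m$ of length $\ell$ has a non-empty $B$-weighted zero-sum subsequence. -}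

module Defs where

open import Data.Nat using (ℕ; _*_; _≤_; _<_; NonZero)
open import Data.Nat.Divisibility using (_∣_)
open import Data.Fin using (Fin; toℕ)
open import Data.Fin.Subset using (Subset; _∈_)
open import Data.List using (List; []; length; zipWith)
open import Data.Nat.ListAction using (sum)
open import Data.List.Relation.Unary.All using (All)
open import Data.List.Relation.Binary.Sublist.Propositional using (_⊆_)
open import Data.Product using (Σ; _×_; ∃)
open import Relation.Binary.PropositionalEquality using (_≡_)
open import Relation.Nullary using (¬_)

-- ℤ_m is represented by Fin m (residues 0..m-1); a sequence over ℤ_m by a list
-- (order irrelevant: sub-multisets are exactly the sublists up to reordering).

WeightedZeroSum : (m : ℕ) → Subset m → List (Fin m) → Set
WeightedZeroSum m B xs =
  Σ (List (Fin m)) λ bs →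
    (length bs ≡ length xs) × All (_∈ B) bs ×
    (m ∣ sum (zipWith (λ b x → toℕ b * toℕ x) bs xs))

HasWZSSub : (m : ℕ) → Subset m → List (Fin m) → Set
HasWZSSub m B xs =
  Σ (List (Fin m)) λ ys → (ys ⊆ xs) × (¬ (ys ≡ [])) × WeightedZeroSum m B ys

AllHave : (m : ℕ) → Subset m → ℕ → Set
AllHave m B ℓ = (xs : List (Fin m)) → length xs ≡ ℓ → HasWZSSub m B xs

IsDB : (m : ℕ) → Subset m → ℕ → Set
IsDB m B ℓ = (1 ≤ ℓ) × AllHave m B ℓ × (∀ k → 1 ≤ k → AllHave m B k → ℓ ≤ k)

-- Embed ℤ_{n₁} into ℤ_{n₁n₂} by x ↦ x and ℤ_{n₂} by y ↦ n₁y. Concatenating the images of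
-- sequences S₁, S₂ of lengths D_{A₁}(ℤ_{n₁}) − 1 and D_{A₂}(ℤ_{n₂}) − 1 without weighted
-- zero-sum subsequences gives a sequence without A-weighted zero-sum subsequence: if
-- Σ bᵢ xᵢ + n₁ Σ cⱼ yⱼ ≡ 0 (mod n₁n₂) with some xᵢ present, reducing mod n₁ gives an
-- A₁-weighted zero-sum inside S₁; otherwise cancelling n₁ gives an A₂-weighted zero-sum
-- inside S₂ after reducing mod n₂. Hence D_A(ℤ_{n₁n₂}) exceeds |S₁| + |S₂|.
module Submission where

open import Defs
open import Data.Nat using (ℕ; zero; suc; _*_; _+_; _≤_; _<_; z≤n; s≤s; NonZero; _%_; _/_)
open import Data.Nat.Properties
  using (+-assoc; +-comm; +-suc; *-zeroʳ; *-identityˡ; ≤-refl; ≰⇒>; <⇒≱;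
         m≤m*n; *-monoʳ-<; m≤n⇒m⊓n≡m; suc-injective; module ≤-Reasoning)
open import Data.Nat.DivMod using (_mod_; m%n<n; m≡m%n+[m/n]*n)
open import Data.Nat.Divisibility using (_∣_; ∣m+n∣m⇒∣n; n∣m*n; m∣m*n; ∣-trans; *-cancelˡ-∣)
open import Data.Nat.ListAction using (sum)
open import Data.Nat.Tactic.RingSolver using (solve-∀)
open import Data.Fin using (Fin; toℕ; inject≤; fromℕ<)
open import Data.Fin.Properties using (toℕ<n; toℕ-fromℕ<; toℕ-inject≤; ∀-cons)
open import Data.Fin.Subset using (Subset; _∈_; Nonempty)
open import Data.List using (List; []; _∷_; length; map; zipWith; _++_; take)
open import Data.List.Properties using (length-map; length-++; length-take)
open import Data.List.Relation.Unary.All using (All)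
import Data.List.Relation.Unary.All as All
import Data.List.Relation.Unary.All.Properties as All
open import Data.List.Relation.Binary.Sublist.Propositional using (_⊆_; []; _∷_; _∷ʳ_; ⊆-trans)
open import Data.List.Relation.Binary.Sublist.Propositional.Properties using (take-⊆)
open import Data.Product using (_×_; _,_; ∃; ∃₂)
open import Data.Sum using (_⊎_; inj₁; inj₂; [_,_]′)
open import Data.Empty using (⊥-elim)
open import Function using (_∘_; id)
open import Relation.Binary.PropositionalEquality using (_≡_; refl; sym; trans; cong; cong₂; subst; module ≡-Reasoning)
open import Relation.Nullary using (¬_)

weightedSum : ∀ {m k} → List (Fin m) → List (Fin k) → ℕ
weightedSum bs xs = sum (zipWith (λ b x → toℕ b * toℕ x) bs xs)

weightedSum-++ : ∀ {m k} (bs₁ bs₂ : List (Fin m)) {us vs : List (Fin k)} →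
  length bs₁ ≡ length us →
  weightedSum (bs₁ ++ bs₂) (us ++ vs) ≡ weightedSum bs₁ us + weightedSum bs₂ vs
weightedSum-++ []        bs₂ {[]}     _  = refl
weightedSum-++ (b ∷ bs₁) bs₂ {u ∷ us} eq = begin
  toℕ b * toℕ u + weightedSum (bs₁ ++ bs₂) (us ++ _)
    ≡⟨ cong (toℕ b * toℕ u +_) (weightedSum-++ bs₁ bs₂ (suc-injective eq)) ⟩
  toℕ b * toℕ u + (weightedSum bs₁ us + weightedSum bs₂ _)
    ≡⟨ +-assoc (toℕ b * toℕ u) _ _ ⟨
  toℕ b * toℕ u + weightedSum bs₁ us + weightedSum bs₂ _ ∎
  where open ≡-Reasoning

weightedSum-map-scale : ∀ {m k j} (f : Fin k → Fin j) (c : ℕ) → (∀ x → toℕ (f x) ≡ c * toℕ x) →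
  (bs : List (Fin m)) (xs : List (Fin k)) → weightedSum bs (map f xs) ≡ c * weightedSum bs xs
weightedSum-map-scale f c f≡c* []       _        = sym (*-zeroʳ c)
weightedSum-map-scale f c f≡c* (_ ∷ _)  []       = sym (*-zeroʳ c)
weightedSum-map-scale f c f≡c* (b ∷ bs) (x ∷ xs) = begin
  toℕ b * toℕ (f x) + weightedSum bs (map f xs)
    ≡⟨ cong₂ (λ y s → toℕ b * y + s) (f≡c* x) (weightedSum-map-scale f c f≡c* bs xs) ⟩
  toℕ b * (c * toℕ x) + c * weightedSum bs xs
    ≡⟨ distrib (toℕ b) c (toℕ x) (weightedSum bs xs) ⟩
  c * (toℕ b * toℕ x + weightedSum bs xs) ∎
  where
  open ≡-Reasoning
  distrib : ∀ a c x s → a * (c * x) + c * s ≡ c * (a * x + s)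
  distrib = solve-∀

reduce : ∀ {m} k .{{_ : NonZero k}} → List (Fin m) → List (Fin k)
reduce k = map (λ b → toℕ b mod k)

weightedSum-reduce : ∀ {m j} k .{{_ : NonZero k}} (bs : List (Fin m)) (xs : List (Fin j)) →
  ∃ λ q → weightedSum bs xs ≡ q * k + weightedSum (reduce k bs) xs
weightedSum-reduce k []       _        = 0 , refl
weightedSum-reduce k (_ ∷ _)  []       = 0 , refl
weightedSum-reduce k (b ∷ bs) (x ∷ xs) with weightedSum-reduce k bs xs
... | q , eq = toℕ b / k * toℕ x + q , (begin
  toℕ b * toℕ x + weightedSum bs xs
    ≡⟨ cong₂ (λ b′ s → b′ * toℕ x + s) (m≡m%n+[m/n]*n (toℕ b) k) eq ⟩
  (toℕ b % k + toℕ b / k * k) * toℕ x + (q * k + s′)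
    ≡⟨ regroup (toℕ b % k) (toℕ b / k) k (toℕ x) q s′ ⟩
  (toℕ b / k * toℕ x + q) * k + (toℕ b % k * toℕ x + s′)
    ≡⟨ cong (λ r → (toℕ b / k * toℕ x + q) * k + (r * toℕ x + s′)) (toℕ-fromℕ< (m%n<n (toℕ b) k)) ⟨
  (toℕ b / k * toℕ x + q) * k + weightedSum (reduce k (b ∷ bs)) (x ∷ xs) ∎)
  where
  open ≡-Reasoning
  s′ : ℕ
  s′ = weightedSum (reduce k bs) xs
  regroup : ∀ r d k x q s → (r + d * k) * x + (q * k + s) ≡ (d * x + q) * k + (r * x + s)
  regroup = solve-∀

WeightedZeroSum-reduce : ∀ {m k} .{{_ : NonZero k}} {B : Subset m} {C : Subset k} →
  (∀ b → b ∈ B → toℕ b mod k ∈ C) →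
  (bs : List (Fin m)) (xs : List (Fin k)) → length bs ≡ length xs → All (_∈ B) bs →
  k ∣ weightedSum bs xs → WeightedZeroSum k C xs
WeightedZeroSum-reduce {k = k} B⇒C bs xs len bs∈B k∣sum with weightedSum-reduce k bs xs
... | q , eq =
  reduce k bs ,
  trans (length-map _ bs) len ,
  All.map⁺ (All.map (B⇒C _) bs∈B) ,
  ∣m+n∣m⇒∣n (subst (k ∣_) eq k∣sum) (n∣m*n q)

⊆-++-split : ∀ {A : Set} (us : List A) {vs ys : List A} → ys ⊆ us ++ vs →
  ∃₂ λ ys₁ ys₂ → ys₁ ⊆ us × ys₂ ⊆ vs × ys ≡ ys₁ ++ ys₂
⊆-++-split []       p = [] , _ , [] , p , refl
⊆-++-split (u ∷ us) (.u ∷ʳ p) with ⊆-++-split us p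
... | ys₁ , ys₂ , p₁ , p₂ , refl = ys₁ , ys₂ , u ∷ʳ p₁ , p₂ , refl
⊆-++-split (u ∷ us) (refl ∷ p) with ⊆-++-split us p
... | ys₁ , ys₂ , p₁ , p₂ , refl = u ∷ ys₁ , ys₂ , refl ∷ p₁ , p₂ , refl

⊆-map-split : ∀ {A B : Set} (f : A → B) (xs : List A) {ys : List B} → ys ⊆ map f xs →
  ∃ λ zs → zs ⊆ xs × ys ≡ map f zs
⊆-map-split f []       [] = [] , [] , refl
⊆-map-split f (x ∷ xs) (.(f x) ∷ʳ p) with ⊆-map-split f xs p
... | zs , q , refl = zs , x ∷ʳ q , refl
⊆-map-split f (x ∷ xs) (refl ∷ p) with ⊆-map-split f xs p
... | zs , q , refl = x ∷ zs , refl ∷ q , refl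

length-++-split : ∀ {A B : Set} (us vs : List A) (bs : List B) → length bs ≡ length (us ++ vs) →
  ∃₂ λ bs₁ bs₂ → length bs₁ ≡ length us × length bs₂ ≡ length vs × bs ≡ bs₁ ++ bs₂
length-++-split []       vs bs       len = [] , bs , refl , len , refl
length-++-split (u ∷ us) vs (b ∷ bs) len with length-++-split us vs bs (suc-injective len)
... | bs₁ , bs₂ , len₁ , len₂ , refl = b ∷ bs₁ , bs₂ , cong suc len₁ , len₂ , refl

¬¬-pull-Fin : ∀ n {P : Fin n → Set} → (∀ i → ¬ ¬ P i) → ¬ ¬ (∀ i → P i)
¬¬-pull-Fin zero    ¬¬P ¬∀P = ¬∀P (λ ())
¬¬-pull-Fin (suc n) ¬¬P ¬∀P =
  ¬¬P Fin.zero λ P₀ → ¬¬-pull-Fin n (¬¬P ∘ Fin.suc) (¬∀P ∘ ∀-cons P₀)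
  where import Data.Fin as Fin

¬¬-pull-List : ∀ {m} k {P : List (Fin m) → Set} →
  (∀ xs → length xs ≡ k → ¬ ¬ P xs) → ¬ ¬ (∀ xs → length xs ≡ k → P xs)
¬¬-pull-List zero    ¬¬P ¬∀P = ¬¬P [] refl λ P[] → ¬∀P λ { [] _ → P[] ; (_ ∷ _) () }
¬¬-pull-List {m} (suc k) ¬¬P ¬∀P =
  ¬¬-pull-Fin m (λ x → ¬¬-pull-List k (λ xs len → ¬¬P (x ∷ xs) (cong suc len)))
    λ ∀P → ¬∀P λ { [] () ; (x ∷ xs) len → ∀P x xs (suc-injective len) }

AllHave-mono : ∀ {m B k l} → k ≤ l → AllHave m B k → AllHave m B l
AllHave-mono {k = k} k≤l allₖ xs refl with allₖ (take k xs) (trans (length-take k xs) (m≤n⇒m⊓n≡m k≤l))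
... | ys , ys⊆ , ys≢[] , zs = ys , ⊆-trans ys⊆ (take-⊆ k xs) , ys≢[] , zs

¬AllHave-0 : ∀ {m B} → ¬ AllHave m B 0
¬AllHave-0 all₀ with all₀ [] refl
... | .[] , [] , []≢[] , _ = []≢[] refl

¬AllHave-< : ∀ {m B ℓ a} → (∀ k → 1 ≤ k → AllHave m B k → ℓ ≤ k) → a < ℓ → ¬ AllHave m B a
¬AllHave-< {a = zero}  least a<ℓ = ¬AllHave-0
¬AllHave-< {a = suc a} least a<ℓ allₐ = <⇒≱ a<ℓ (least (suc a) (s≤s z≤n) allₐ)

module Embedding (n₁ n₂ : ℕ) .{{_ : NonZero n₁}} .{{_ : NonZero n₂}} where

  ι₁ : Fin n₁ → Fin (n₁ * n₂)
  ι₁ x = inject≤ x (m≤m*n n₁ n₂)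

  ι₂ : Fin n₂ → Fin (n₁ * n₂)
  ι₂ y = fromℕ< (*-monoʳ-< n₁ (toℕ<n y))

  toℕ-ι₁ : ∀ x → toℕ (ι₁ x) ≡ 1 * toℕ x
  toℕ-ι₁ x = trans (toℕ-inject≤ x _) (sym (*-identityˡ (toℕ x)))

  toℕ-ι₂ : ∀ y → toℕ (ι₂ y) ≡ n₁ * toℕ y
  toℕ-ι₂ y = toℕ-fromℕ< _

  embed : List (Fin n₁) → List (Fin n₂) → List (Fin (n₁ * n₂))
  embed S₁ S₂ = map ι₁ S₁ ++ map ι₂ S₂

  length-embed : ∀ S₁ S₂ → length (embed S₁ S₂) ≡ length S₁ + length S₂
  length-embed S₁ S₂ =
    trans (length-++ (map ι₁ S₁)) (cong₂ _+_ (length-map ι₁ S₁) (length-map ι₂ S₂))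

  ⊆-embed : ∀ {S₁ S₂ ys} → ys ⊆ embed S₁ S₂ →
    ∃₂ λ T₁ T₂ → T₁ ⊆ S₁ × T₂ ⊆ S₂ × ys ≡ embed T₁ T₂
  ⊆-embed {S₁} {S₂} ys⊆ with ⊆-++-split (map ι₁ S₁) ys⊆
  ... | ys₁ , ys₂ , p₁ , p₂ , refl with ⊆-map-split ι₁ S₁ p₁ | ⊆-map-split ι₂ S₂ p₂
  ... | T₁ , q₁ , refl | T₂ , q₂ , refl = T₁ , T₂ , q₁ , q₂ , refl

  weightedSum-embed : ∀ {m} (bs₁ bs₂ : List (Fin m)) T₁ T₂ → length bs₁ ≡ length T₁ →
    weightedSum (bs₁ ++ bs₂) (embed T₁ T₂) ≡ weightedSum bs₁ T₁ + n₁ * weightedSum bs₂ T₂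
  weightedSum-embed bs₁ bs₂ T₁ T₂ len = begin
    weightedSum (bs₁ ++ bs₂) (embed T₁ T₂)
      ≡⟨ weightedSum-++ bs₁ bs₂ (trans len (sym (length-map ι₁ T₁))) ⟩
    weightedSum bs₁ (map ι₁ T₁) + weightedSum bs₂ (map ι₂ T₂)
      ≡⟨ cong₂ _+_ (weightedSum-map-scale ι₁ 1 toℕ-ι₁ bs₁ T₁) (weightedSum-map-scale ι₂ n₁ toℕ-ι₂ bs₂ T₂) ⟩
    1 * weightedSum bs₁ T₁ + n₁ * weightedSum bs₂ T₂
      ≡⟨ cong (_+ n₁ * weightedSum bs₂ T₂) (*-identityˡ _) ⟩
    weightedSum bs₁ T₁ + n₁ * weightedSum bs₂ T₂ ∎
    where open ≡-Reasoning

  module _ (A : Subset (n₁ * n₂)) (A₁ : Subset n₁) (A₂ : Subset n₂)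
    (A⇒A₁ : ∀ (x : Fin (n₁ * n₂)) → x ∈ A → (toℕ x mod n₁) ∈ A₁)
    (A⇒A₂ : ∀ (x : Fin (n₁ * n₂)) → x ∈ A → (toℕ x mod n₂) ∈ A₂) where

    WeightedZeroSum-embed : ∀ T₁ T₂ → ¬ embed T₁ T₂ ≡ [] → WeightedZeroSum (n₁ * n₂) A (embed T₁ T₂) →
      (¬ T₁ ≡ [] × WeightedZeroSum n₁ A₁ T₁) ⊎ (¬ T₂ ≡ [] × WeightedZeroSum n₂ A₂ T₂)
    WeightedZeroSum-embed [] T₂ ≢[] (bs , len , bs∈A , ∣sum) =
      inj₂ (≢[] ∘ cong (map ι₂) ,
            WeightedZeroSum-reduce A⇒A₂ bs T₂ (trans len (length-map ι₂ T₂)) bs∈A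
              (*-cancelˡ-∣ n₁ (subst (n₁ * n₂ ∣_) (weightedSum-map-scale ι₂ n₁ toℕ-ι₂ bs T₂) ∣sum)))
    WeightedZeroSum-embed T₁@(_ ∷ _) T₂ _ (bs , len , bs∈A , ∣sum)
      with length-++-split (map ι₁ T₁) (map ι₂ T₂) bs len
    ... | bs₁ , bs₂ , len₁ , _ , refl =
      inj₁ ((λ ()) , WeightedZeroSum-reduce A⇒A₁ bs₁ T₁ len₁′ (All.++⁻ˡ bs₁ bs∈A) n₁∣sum₁)
      where
      len₁′ : length bs₁ ≡ length T₁
      len₁′ = trans len₁ (length-map ι₁ T₁)
      n₁∣sum : n₁ ∣ weightedSum bs₁ T₁ + n₁ * weightedSum bs₂ T₂
      n₁∣sum = ∣-trans (m∣m*n n₂) (subst (n₁ * n₂ ∣_) (weightedSum-embed bs₁ bs₂ T₁ T₂ len₁′) ∣sum)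
      n₁∣sum₁ : n₁ ∣ weightedSum bs₁ T₁
      n₁∣sum₁ = ∣m+n∣m⇒∣n (subst (n₁ ∣_) (+-comm (weightedSum bs₁ T₁) _) n₁∣sum) (m∣m*n _)

    HasWZSSub-embed : ∀ S₁ S₂ → HasWZSSub (n₁ * n₂) A (embed S₁ S₂) →
      HasWZSSub n₁ A₁ S₁ ⊎ HasWZSSub n₂ A₂ S₂
    HasWZSSub-embed S₁ S₂ (ys , ys⊆ , ys≢[] , zs) with ⊆-embed ys⊆
    ... | T₁ , T₂ , T₁⊆ , T₂⊆ , refl with WeightedZeroSum-embed T₁ T₂ ys≢[] zs
    ... | inj₁ (T₁≢[] , zs₁) = inj₁ (T₁ , T₁⊆ , T₁≢[] , zs₁)
    ... | inj₂ (T₂≢[] , zs₂) = inj₂ (T₂ , T₂⊆ , T₂≢[] , zs₂)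

    -- The least-ness of D only says that sequences without weighted zero-sum subsequence are
    -- not absent, so they are combined under a double negation, pulled through ∀ by ¬¬-pull-List.
    ¬AllHave-+ : ∀ a b → ¬ AllHave n₁ A₁ a → ¬ AllHave n₂ A₂ b → ¬ AllHave (n₁ * n₂) A (a + b)
    ¬AllHave-+ a b ¬all₁ ¬all₂ all = ¬¬-pull-List b ¬¬has₂ ¬all₂
      where
      ¬¬has₂ : ∀ S₂ → length S₂ ≡ b → ¬ ¬ HasWZSSub n₂ A₂ S₂
      ¬¬has₂ S₂ len₂ ¬has₂ = ¬all₁ λ S₁ len₁ →
        [ id , ⊥-elim ∘ ¬has₂ ]′
          (HasWZSSub-embed S₁ S₂ (all (embed S₁ S₂) (trans (length-embed S₁ S₂) (cong₂ _+_ len₁ len₂))))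

lemma3p1 : (n₁ n₂ : ℕ) → .{{_ : NonZero n₁}} → .{{_ : NonZero n₂}} →
    (A : Subset (n₁ * n₂)) (A₁ : Subset n₁) (A₂ : Subset n₂) →
    Nonempty A → Nonempty A₁ → Nonempty A₂ →
    (∀ (x : Fin (n₁ * n₂)) → x ∈ A → (toℕ x mod n₁) ∈ A₁) →
    (∀ (x : Fin (n₁ * n₂)) → x ∈ A → (toℕ x mod n₂) ∈ A₂) →
    (d d₁ d₂ : ℕ) → IsDB (n₁ * n₂) A d → IsDB n₁ A₁ d₁ → IsDB n₂ A₂ d₂ →
    d₁ + d₂ ≤ d + 1
lemma3p1 _ _ _ _ _ _ _ _ _ _ _ zero _ _ (() , _) _
lemma3p1 _ _ _ _ _ _ _ _ _ _ _ (suc _) zero _ _ (() , _)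
lemma3p1 n₁ n₂ A A₁ A₂ _ _ _ A⇒A₁ A⇒A₂ d (suc a) (suc b) (_ , all , _) (_ , _ , least₁) (_ , _ , least₂) =
  begin
    suc a + suc b     ≡⟨ cong suc (+-suc a b) ⟩
    suc (suc (a + b)) ≤⟨ s≤s a+b<d ⟩
    suc d             ≡⟨ +-comm 1 d ⟩
    d + 1             ∎
  where
  open ≤-Reasoning
  a+b<d : a + b < d
  a+b<d = ≰⇒> λ d≤a+b →
    Embedding.¬AllHave-+ n₁ n₂ A A₁ A₂ A⇒A₁ A⇒A₂ a b
      (¬AllHave-< least₁ ≤-refl) (¬AllHave-< least₂ ≤-refl) (AllHave-mono d≤a+b all)
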